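{- Let $\Gamma$ be a finite undirected multigraph (self-loops and parallel edges allowed) with vertex set $V$ and edge set $E$, and fix a vertex $v\in V$. Let $G$ be any subset of $E$. Then \[ \sum_{\substack{F\subseteq E;\\ G\not\subseteq \operatorname{Shade}F}}(-1)^{|F|}=0 . \]
   Context: For $F\subseteq E$, an $F$-path is a path of $\Gamma$ all of whose edges belong to $F$ (an edgeless path is allowed). For $e\in E$ and $F\subseteq E$, $F$ infects $e$ if there is an $F$-path from $v$ to some endpoint of $e$. The shade of $F\subseteq E$ is $\operatorname{Shade}F=\{e\in E \mid F\text{ infects }e\}$. -}

module Defs where

open import Data.Nat using (ℕ; zero; suc)
open import Data.Fin using (Fin)
open import Data.Fin.Subset using (Subset; inside; outside; _∈_; ∣_∣)
open import Data.Vec using ([]; _∷_)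
open import Data.Product using (_×_; proj₁; proj₂)
open import Data.Sum using (_⊎_)
open import Data.List using (List; []; _∷_; _++_; map; foldr; filter)
open import Data.Integer using (ℤ; _+_; _^_; -_; 1ℤ; 0ℤ)
open import Relation.Nullary using (Dec; ¬_)
open import Relation.Nullary.Decidable using (¬?)

-- A finite undirected multigraph: vertices Fin n, edges Fin m, and each edge
-- has an (unordered) pair of endpoints, recorded as an ordered pair whose
-- order is irrelevant below.
record Multigraph : Set where
  field
    nV   : ℕ
    nE   : ℕ
    ends : Fin nE → Fin nV × Fin nV
open Multigraph public

module _ (Γ : Multigraph) (F : Subset (nE Γ)) where
  data FPath (a : Fin (nV Γ)) : Fin (nV Γ) → Set where
    here  : FPath a a
    fwd   : ∀ {e} → e ∈ F → FPath a (proj₁ (ends Γ e)) → FPath a (proj₂ (ends Γ e))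
    bwd   : ∀ {e} → e ∈ F → FPath a (proj₂ (ends Γ e)) → FPath a (proj₁ (ends Γ e))

Infects : (Γ : Multigraph) (v : Fin (nV Γ)) (F : Subset (nE Γ)) → Fin (nE Γ) → Set
Infects Γ v F e = FPath Γ F v (proj₁ (ends Γ e)) ⊎ FPath Γ F v (proj₂ (ends Γ e))

InShade : (Γ : Multigraph) (v : Fin (nV Γ)) (F : Subset (nE Γ)) → Fin (nE Γ) → Set
InShade = Infects

SubShade : (Γ : Multigraph) (v : Fin (nV Γ)) (G F : Subset (nE Γ)) → Set
SubShade Γ v G F = ∀ e → e ∈ G → InShade Γ v F e

allSubsets : (m : ℕ) → List (Subset m)
allSubsets zero = [] ∷ []
allSubsets (suc m) = map (inside ∷_) (allSubsets m) ++ map (outside ∷_) (allSubsets m)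

sumℤ : List ℤ → ℤ
sumℤ = foldr _+_ 0ℤ

sgn : ∀ {m} → Subset m → ℤ
sgn F = (- 1ℤ) ^ ∣ F ∣

-- Σ_{F ⊆ E, G ⊄ Shade F} (-1)^|F|, given any decision procedure for G ⊆ Shade F
-- (Dec values are unique, so the sum does not depend on the choice).
shadeSum : (Γ : Multigraph) (v : Fin (nV Γ)) (G : Subset (nE Γ))
           (d : ∀ F → Dec (SubShade Γ v G F)) → ℤ
shadeSum Γ v G d = sumℤ (map sgn (filter (λ F → ¬? (d F)) (allSubsets (nE Γ))))

-- A sign-reversing involution. If G ⊄ Shade F, pick an edge e ∈ G outside
-- Shade F. No F-path from v reaches an endpoint of e, so adding or removing e
-- from F changes no F-path from v, hence neither the shade nor the choice of e;
-- toggling e therefore pairs up the summands, which carry opposite signs.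
-- Deciding whether F infects e needs excluded middle, which is harmless since
-- the goal, an equation between integers, is decidable and thus ¬¬-stable.
module Submission where

open import Defs
open import Data.Fin using (Fin)
open import Data.Fin.Subset using (Subset)
open import Data.Integer using (0ℤ)
open import Relation.Nullary using (Dec)
open import Relation.Binary.PropositionalEquality using (_≡_)

open import Data.Bool using (true; false; not; _∧_; if_then_else_)
open import Data.Bool.Properties using (not-involutive)
open import Data.Empty using (⊥-elim)
open import Data.Nat using (zero; suc)
open import Data.Fin using (zero; suc; _≟_)
open import Data.Fin.Subset using (inside; outside; _∈_; Empty)
open import Data.Fin.Subset.Properties using (_∈?_; nonempty?)
open import Data.Integer using (ℤ; _+_; -_)
import Data.Integer as ℤ
open import Data.Integer.Properties
  using (+-identityˡ; +-identityʳ; +-assoc; +-inverseʳ; -1*i≡-i; neg-involutive;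
         +-0-commutativeMonoid; +-commutativeSemigroup)
open import Data.List using (List; []; _∷_; _++_; map; filter)
open import Data.List.Properties using (map-++; map-∘; map-cong)
open import Data.Maybe using (Maybe; just; nothing)
open import Data.Maybe.Properties using (≡-dec)
open import Data.Product using (_×_; _,_; proj₁; proj₂)
open import Data.Sum using (inj₁; inj₂)
import Data.Sum as Sum
open import Data.Vec using ([]; _∷_; tabulate; updateAt)
open import Data.Vec.Properties
  using (updateAt-updateAt-local; updateAt-id; updateAt-minimal;
         lookup∘tabulate; lookup⇒[]=; []=⇒lookup; tabulate-cong)
open import Function using (_∘_; _⇔_; mk⇔; Equivalence)
open import Relation.Binary.PropositionalEquality
  using (refl; sym; trans; cong; cong₂; subst; _≢_; _≗_; module ≡-Reasoning)
open import Relation.Nullary using (¬_; yes; no; does; contradiction; _×-dec_)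
open import Relation.Nullary.Decidable
  using (¬?; dec-true; dec-false; does-⇔; decidable-stable; ¬¬-excluded-middle)
open import Relation.Nullary.Negation using (¬¬-map)
open import Relation.Unary using (Pred; Decidable)
open import Level using (0ℓ)
open import Algebra.Properties.CommutativeSemigroup +-commutativeSemigroup using (interchange)
open import Algebra.Properties.CommutativeMonoid.Sum +-0-commutativeMonoid
  using (sum-syntax; ∑-distrib-+; sum-replicate-zero; sum-cong-≗)

open ≡-Reasoning

sumℤ-++ : (xs ys : List ℤ) → sumℤ (xs ++ ys) ≡ sumℤ xs + sumℤ ys
sumℤ-++ []       ys = sym (+-identityˡ (sumℤ ys))
sumℤ-++ (x ∷ xs) ys = trans (cong (x +_) (sumℤ-++ xs ys)) (sym (+-assoc x (sumℤ xs) (sumℤ ys)))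

sumℤ-map-cong : ∀ {A : Set} {f g : A → ℤ} → f ≗ g → ∀ xs → sumℤ (map f xs) ≡ sumℤ (map g xs)
sumℤ-map-cong f≗g xs = cong sumℤ (map-cong f≗g xs)

sumℤ-map-zero : ∀ {A : Set} (xs : List A) → sumℤ (map (λ _ → 0ℤ) xs) ≡ 0ℤ
sumℤ-map-zero []       = refl
sumℤ-map-zero (x ∷ xs) = trans (+-identityˡ _) (sumℤ-map-zero xs)

sumℤ-map-+ : ∀ {A : Set} (f g : A → ℤ) (xs : List A) →
             sumℤ (map (λ x → f x + g x) xs) ≡ sumℤ (map f xs) + sumℤ (map g xs)
sumℤ-map-+ f g []       = refl
sumℤ-map-+ f g (x ∷ xs) = begin
  f x + g x + sumℤ (map (λ y → f y + g y) xs)  ≡⟨ cong (f x + g x +_) (sumℤ-map-+ f g xs) ⟩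
  f x + g x + (∑f + ∑g)                        ≡⟨ interchange (f x) (g x) ∑f ∑g ⟩
  f x + ∑f + (g x + ∑g)                        ∎
  where
  ∑f = sumℤ (map f xs)
  ∑g = sumℤ (map g xs)

sumℤ-map-∑ : ∀ {A : Set} n (g : Fin n → A → ℤ) (xs : List A) →
             sumℤ (map (λ x → ∑[ i < n ] g i x) xs) ≡ ∑[ i < n ] sumℤ (map (g i) xs)
sumℤ-map-∑ n g []       = sym (sum-replicate-zero n)
sumℤ-map-∑ n g (x ∷ xs) = begin
  ∑[ i < n ] g i x + sumℤ (map (λ y → ∑[ i < n ] g i y) xs)
    ≡⟨ cong (∑[ i < n ] g i x +_) (sumℤ-map-∑ n g xs) ⟩
  ∑[ i < n ] g i x + ∑[ i < n ] sumℤ (map (g i) xs)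
    ≡⟨ sym (∑-distrib-+ (λ i → g i x) (λ i → sumℤ (map (g i) xs))) ⟩
  ∑[ i < n ] (g i x + sumℤ (map (g i) xs))
    ∎

sumℤ-filter : ∀ {A : Set} {P : Pred A 0ℓ} (P? : Decidable P) (f : A → ℤ) (xs : List A) →
              sumℤ (map f (filter P? xs)) ≡ sumℤ (map (λ x → if does (P? x) then f x else 0ℤ) xs)
sumℤ-filter P? f [] = refl
sumℤ-filter P? f (x ∷ xs) with does (P? x)
... | true  = cong (f x +_) (sumℤ-filter P? f xs)
... | false = trans (sumℤ-filter P? f xs) (sym (+-identityˡ _))

∑ₛ : ∀ {m} → (Subset m → ℤ) → ℤ
∑ₛ {m} f = sumℤ (map f (allSubsets m))

∑ₛ-suc : ∀ {m} (f : Subset (suc m) → ℤ) →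
         ∑ₛ f ≡ ∑ₛ (f ∘ (inside ∷_)) + ∑ₛ (f ∘ (outside ∷_))
∑ₛ-suc {m} f = begin
  sumℤ (map f (map (inside ∷_) Fs ++ map (outside ∷_) Fs))
    ≡⟨ cong sumℤ (map-++ f (map (inside ∷_) Fs) (map (outside ∷_) Fs)) ⟩
  sumℤ (map f (map (inside ∷_) Fs) ++ map f (map (outside ∷_) Fs))
    ≡⟨ sumℤ-++ (map f (map (inside ∷_) Fs)) (map f (map (outside ∷_) Fs)) ⟩
  sumℤ (map f (map (inside ∷_) Fs)) + sumℤ (map f (map (outside ∷_) Fs))
    ≡⟨ sym (cong₂ _+_ (cong sumℤ (map-∘ Fs)) (cong sumℤ (map-∘ Fs))) ⟩
  ∑ₛ (f ∘ (inside ∷_)) + ∑ₛ (f ∘ (outside ∷_))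
    ∎
  where Fs = allSubsets m

toggle : ∀ {m} → Fin m → Subset m → Subset m
toggle i F = updateAt F i not

toggle-involutive : ∀ {m} (i : Fin m) F → toggle i (toggle i F) ≡ F
toggle-involutive i F =
  trans (updateAt-updateAt-local i F (not-involutive _)) (updateAt-id i F)

∈-toggle : ∀ {m} {i x : Fin m} {F} → x ≢ i → x ∈ F → x ∈ toggle i F
∈-toggle {i = i} {x} {F} = updateAt-minimal x i F

∈-toggle⁻ : ∀ {m} {i x : Fin m} {F} → x ≢ i → x ∈ toggle i F → x ∈ F
∈-toggle⁻ {i = i} {F = F} x≢i x∈ = subst (_ ∈_) (toggle-involutive i F) (∈-toggle x≢i x∈)

sgn-inside : ∀ {m} (F : Subset m) → sgn (inside ∷ F) ≡ - sgn F
sgn-inside F = -1*i≡-i (sgn F)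

sgn-toggle : ∀ {m} (i : Fin m) F → sgn (toggle i F) ≡ - sgn F
sgn-toggle zero    (inside ∷ F)  = sym (trans (cong -_ (sgn-inside F)) (neg-involutive (sgn F)))
sgn-toggle zero    (outside ∷ F) = sgn-inside F
sgn-toggle (suc i) (inside ∷ F)  = begin
  sgn (inside ∷ toggle i F)  ≡⟨ sgn-inside (toggle i F) ⟩
  - sgn (toggle i F)         ≡⟨ cong -_ (sgn-toggle i F) ⟩
  - - sgn F                  ≡⟨ cong -_ (sgn-inside F) ⟨
  - sgn (inside ∷ F)         ∎
sgn-toggle (suc i) (outside ∷ F) = sgn-toggle i F

∑ₛ-toggle-odd : ∀ {m} (i : Fin m) (f : Subset m → ℤ) →
                (∀ F → f (toggle i F) ≡ - f F) → ∑ₛ f ≡ 0ℤ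
∑ₛ-toggle-odd {suc m} zero f odd = begin
  ∑ₛ f                                         ≡⟨ ∑ₛ-suc f ⟩
  ∑ₛ (f ∘ (inside ∷_)) + ∑ₛ (f ∘ (outside ∷_))  ≡⟨ sumℤ-map-+ _ _ (allSubsets m) ⟨
  ∑ₛ (λ F → f (inside ∷ F) + f (outside ∷ F))  ≡⟨ sumℤ-map-cong cancels (allSubsets m) ⟩
  sumℤ (map (λ _ → 0ℤ) (allSubsets m))         ≡⟨ sumℤ-map-zero (allSubsets m) ⟩
  0ℤ                                           ∎
  where
  cancels : ∀ F → f (inside ∷ F) + f (outside ∷ F) ≡ 0ℤ
  cancels F = trans (cong (f (inside ∷ F) +_) (odd (inside ∷ F))) (+-inverseʳ (f (inside ∷ F)))
∑ₛ-toggle-odd {suc m} (suc i) f odd = begin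
  ∑ₛ f                                          ≡⟨ ∑ₛ-suc f ⟩
  ∑ₛ (f ∘ (inside ∷_)) + ∑ₛ (f ∘ (outside ∷_))  ≡⟨ cong₂ _+_ (∑ₛ-toggle-odd i _ (odd ∘ (inside ∷_)))
                                                            (∑ₛ-toggle-odd i _ (odd ∘ (outside ∷_))) ⟩
  0ℤ                                            ∎

mask : ∀ {m} → Maybe (Fin m) → Fin m → ℤ → ℤ
mask nothing  j x = 0ℤ
mask (just i) j x = if does (i ≟ j) then x else 0ℤ

mask-self : ∀ {m} (j : Fin m) x → mask (just j) j x ≡ x
mask-self j x rewrite dec-true (j ≟ j) refl = refl

mask-other : ∀ {m} {o : Maybe (Fin m)} {j} x → o ≢ just j → mask o j x ≡ 0ℤ
mask-other {o = nothing} x o≢j = refl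
mask-other {o = just i} {j} x o≢j rewrite dec-false (i ≟ j) (o≢j ∘ cong just) = refl

∑-mask-just : ∀ {m} (i : Fin m) x → ∑[ j < m ] mask (just i) j x ≡ x
∑-mask-just {suc m} zero x = trans (cong (x +_) (sum-replicate-zero m)) (+-identityʳ x)
∑-mask-just {suc m} (suc i) x = trans (+-identityˡ _) (∑-mask-just i x)

∑-mask : ∀ {m} (o : Maybe (Fin m)) x → (o ≡ nothing → x ≡ 0ℤ) → ∑[ j < m ] mask o j x ≡ x
∑-mask {m} nothing  x x≡0 = trans (sum-replicate-zero m) (sym (x≡0 refl))
∑-mask     (just i) x _   = ∑-mask-just i x

∑ₛ-cancel-choice :
  ∀ {m} (f : Subset m → ℤ) (k : Subset m → Maybe (Fin m)) →
  (∀ F → k F ≡ nothing → f F ≡ 0ℤ) →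
  (∀ F i → k F ≡ just i → k (toggle i F) ≡ just i × f (toggle i F) ≡ - f F) →
  ∑ₛ f ≡ 0ℤ
-- Split f F as the sum over j of its part supported on k F = just j; the j-th
-- part is odd under toggling j, so it sums to zero.
∑ₛ-cancel-choice {m} f k unchosen chosen = begin
  ∑ₛ f                                      ≡⟨ sumℤ-map-cong split (allSubsets m) ⟩
  ∑ₛ (λ F → ∑[ j < m ] mask (k F) j (f F))  ≡⟨ sumℤ-map-∑ m (λ j F → mask (k F) j (f F)) (allSubsets m) ⟩
  ∑[ j < m ] ∑ₛ (λ F → mask (k F) j (f F))  ≡⟨ sum-cong-≗ (λ j → ∑ₛ-toggle-odd j _ (masked-odd j)) ⟩
  ∑[ j < m ] 0ℤ                             ≡⟨ sum-replicate-zero m ⟩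
  0ℤ                                        ∎
  where
  split : ∀ F → f F ≡ ∑[ j < m ] mask (k F) j (f F)
  split F = sym (∑-mask (k F) (f F) (unchosen F))

  masked-odd : ∀ j F → mask (k (toggle j F)) j (f (toggle j F)) ≡ - mask (k F) j (f F)
  masked-odd j F with ≡-dec _≟_ (k F) (just j)
  ... | yes kF≡j rewrite kF≡j | proj₁ (chosen F j kF≡j) = begin
    mask (just j) j (f (toggle j F))  ≡⟨ mask-self j _ ⟩
    f (toggle j F)                    ≡⟨ proj₂ (chosen F j kF≡j) ⟩
    - f F                             ≡⟨ cong -_ (mask-self j (f F)) ⟨
    - mask (just j) j (f F)           ∎
  ... | no kF≢j = trans (mask-other _ k′≢j) (cong -_ (sym (mask-other _ kF≢j)))
    where
    k′≢j : k (toggle j F) ≢ just j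
    k′≢j k′≡j = kF≢j (subst (λ F′ → k F′ ≡ just j) (toggle-involutive j F)
                              (proj₁ (chosen (toggle j F) j k′≡j)))

pick : ∀ {m} → Subset m → Maybe (Fin m)
pick p with nonempty? p
... | yes (i , _) = just i
... | no _        = nothing

pick-just : ∀ {m} {p : Subset m} {i} → pick p ≡ just i → i ∈ p
pick-just {p = p} eq with nonempty? p
pick-just refl | yes (i , i∈p) = i∈p

pick-nothing : ∀ {m} {p : Subset m} → pick p ≡ nothing → Empty p
pick-nothing {p = p} eq with nonempty? p
pick-nothing refl | no ¬nonempty = ¬nonempty

∑ₛ-cancel :
  ∀ {m} (f : Subset m → ℤ) (B : Subset m → Subset m) →
  (∀ F → Empty (B F) → f F ≡ 0ℤ) →
  (∀ F i → i ∈ B F → B (toggle i F) ≡ B F) →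
  (∀ F i → i ∈ B F → f (toggle i F) ≡ - f F) →
  ∑ₛ f ≡ 0ℤ
∑ₛ-cancel f B empty stable odd = ∑ₛ-cancel-choice f (pick ∘ B)
  (λ F k≡nothing → empty F (pick-nothing k≡nothing))
  (λ F i k≡i → trans (cong pick (stable F i (pick-just k≡i))) k≡i , odd F i (pick-just k≡i))

module _ {Γ : Multigraph} where

  FPath-transfer : ∀ {F F′ a b} e → (∀ {x} → x ≢ e → x ∈ F′ → x ∈ F) →
                   ¬ Infects Γ a F e → FPath Γ F′ a b → FPath Γ F a b
  FPath-transfer e F′⊆F ¬inf here = here
  FPath-transfer e F′⊆F ¬inf (fwd {x} x∈F′ p) with x ≟ e | FPath-transfer e F′⊆F ¬inf p
  ... | yes refl | p′ = contradiction (inj₁ p′) ¬inf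
  ... | no x≢e   | p′ = fwd (F′⊆F x≢e x∈F′) p′
  FPath-transfer e F′⊆F ¬inf (bwd {x} x∈F′ p) with x ≟ e | FPath-transfer e F′⊆F ¬inf p
  ... | yes refl | p′ = contradiction (inj₂ p′) ¬inf
  ... | no x≢e   | p′ = bwd (F′⊆F x≢e x∈F′) p′

  Infects-toggle⁻ : ∀ {F a e x} → ¬ Infects Γ a F e →
                    Infects Γ a (toggle e F) x → Infects Γ a F x
  Infects-toggle⁻ ¬inf = Sum.map (FPath-transfer _ ∈-toggle⁻ ¬inf) (FPath-transfer _ ∈-toggle⁻ ¬inf)

  Infects-toggle : ∀ {F a e x} → ¬ Infects Γ a F e →
                   Infects Γ a (toggle e F) x ⇔ Infects Γ a F x
  Infects-toggle ¬inf = mk⇔ (Infects-toggle⁻ ¬inf)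
    (Sum.map (FPath-transfer _ ∈-toggle ¬inf′) (FPath-transfer _ ∈-toggle ¬inf′))
    where ¬inf′ = ¬inf ∘ Infects-toggle⁻ ¬inf

  SubShade-toggle : ∀ {v G F e} → ¬ Infects Γ v F e →
                    SubShade Γ v G (toggle e F) ⇔ SubShade Γ v G F
  SubShade-toggle ¬inf = mk⇔
    (λ G⊆ x x∈G → Equivalence.to (Infects-toggle ¬inf) (G⊆ x x∈G))
    (λ G⊆ x x∈G → Equivalence.from (Infects-toggle ¬inf) (G⊆ x x∈G))

module _ {m} {P : Pred (Fin m) 0ℓ} (P? : Decidable P) where

  ∈-tabulate⁺ : ∀ {x} → P x → x ∈ tabulate (does ∘ P?)
  ∈-tabulate⁺ {x} px = lookup⇒[]= x _ (trans (lookup∘tabulate (does ∘ P?) x) (dec-true (P? x) px))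

  ∈-tabulate⁻ : ∀ {x} → x ∈ tabulate (does ∘ P?) → P x
  ∈-tabulate⁻ {x} x∈ with P? x | trans (sym (lookup∘tabulate (does ∘ P?) x)) ([]=⇒lookup x∈)
  ... | yes px | _ = px
  ... | no _   | ()

module _ (Γ : Multigraph) (v : Fin (nV Γ)) (G : Subset (nE Γ))
         (infects? : ∀ F e → Dec (Infects Γ v F e)) where

  unshaded? : ∀ F e → Dec (e ∈ G × ¬ Infects Γ v F e)
  unshaded? F e = e ∈? G ×-dec ¬? (infects? F e)

  unshaded : Subset (nE Γ) → Subset (nE Γ)
  unshaded F = tabulate (does ∘ unshaded? F)

  unshaded-toggle : ∀ F i → i ∈ unshaded F → unshaded (toggle i F) ≡ unshaded F
  unshaded-toggle F i i∈ = tabulate-cong λ e →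
    cong (λ b → does (e ∈? G) ∧ not b)
         (does-⇔ (Infects-toggle ¬inf) (infects? (toggle i F) e) (infects? F e))
    where ¬inf = proj₂ (∈-tabulate⁻ (unshaded? F) i∈)

  SubShade-unshaded : ∀ F → Empty (unshaded F) → SubShade Γ v G F
  SubShade-unshaded F empty e e∈G with infects? F e
  ... | yes inf = inf
  ... | no ¬inf = ⊥-elim (empty (e , ∈-tabulate⁺ (unshaded? F) (e∈G , ¬inf)))

  shadeSum-vanishes : (d : ∀ F → Dec (SubShade Γ v G F)) → shadeSum Γ v G d ≡ 0ℤ
  shadeSum-vanishes d =
    trans (sumℤ-filter (λ F → ¬? (d F)) sgn (allSubsets (nE Γ)))
          (∑ₛ-cancel summand unshaded shaded unshaded-toggle odd)
    where
    summand : Subset (nE Γ) → ℤ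
    summand F = if does (¬? (d F)) then sgn F else 0ℤ

    shaded : ∀ F → Empty (unshaded F) → summand F ≡ 0ℤ
    shaded F empty rewrite dec-true (d F) (SubShade-unshaded F empty) = refl

    odd : ∀ F i → i ∈ unshaded F → summand (toggle i F) ≡ - summand F
    odd F i i∈
      rewrite does-⇔ (SubShade-toggle (proj₂ (∈-tabulate⁻ (unshaded? F) i∈))) (d (toggle i F)) (d F)
      with does (d F)
    ... | true  = refl
    ... | false = sgn-toggle i F

¬¬-∀-Fin : ∀ n {P : Fin n → Set} → (∀ i → ¬ ¬ P i) → ¬ ¬ (∀ i → P i)
¬¬-∀-Fin zero    ¬¬P ¬∀P = ¬∀P λ ()
¬¬-∀-Fin (suc n) ¬¬P ¬∀P =
  ¬¬P zero λ p₀ → ¬¬-∀-Fin n (¬¬P ∘ suc) λ pₛ → ¬∀P λ { zero → p₀ ; (suc i) → pₛ i }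

¬¬-∀-Subset : ∀ n {P : Subset n → Set} → (∀ F → ¬ ¬ P F) → ¬ ¬ (∀ F → P F)
¬¬-∀-Subset zero    ¬¬P ¬∀P = ¬¬P [] λ p → ¬∀P λ { [] → p }
¬¬-∀-Subset (suc n) ¬¬P ¬∀P =
  ¬¬-∀-Subset n (¬¬P ∘ (inside ∷_)) λ p-in → ¬¬-∀-Subset n (¬¬P ∘ (outside ∷_)) λ p-out →
  ¬∀P λ { (inside ∷ F) → p-in F ; (outside ∷ F) → p-out F }

theorem2p11 : (Γ : Multigraph) (v : Fin (nV Γ)) (G : Subset (nE Γ))
              (d : ∀ F → Dec (SubShade Γ v G F)) →
              shadeSum Γ v G d ≡ 0ℤ
theorem2p11 Γ v G d = decidable-stable (shadeSum Γ v G d ℤ.≟ 0ℤ)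
  (¬¬-map (λ infects? → shadeSum-vanishes Γ v G infects? d) ¬¬infects?)
  where
  ¬¬infects? : ¬ ¬ (∀ F e → Dec (Infects Γ v F e))
  ¬¬infects? = ¬¬-∀-Subset (nE Γ) λ F → ¬¬-∀-Fin (nE Γ) λ e → ¬¬-excluded-middle
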